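{- For any graph $G$, $\chi_{\ell}(K_1 \vee G) - \chi(K_1 \vee G) \leq \chi_{\ell}(G) - \chi(G)$.
   Context: All graphs are finite, simple and nonempty. For graphs $G,H$ on disjoint vertex sets, the join $G \vee H$ is the graph consisting of $G$, $H$, and all edges joining a vertex of $G$ to a vertex of $H$; $K_1$ is a single vertex. $\chi$ denotes chromatic number and $\chi_\ell$ list chromatic number. -}

module Defs where

open import Data.Nat using (ℕ; zero; suc; _≤_)
open import Data.Fin using (Fin; zero; suc)
open import Data.Bool using (Bool; true; false)
open import Data.List using (List; length)
open import Data.List.Membership.Propositional using (_∈_)
open import Data.List.Relation.Unary.Unique.Propositional using (Unique)
open import Data.Product using (Σ; _×_)
open import Relation.Binary.PropositionalEquality using (_≡_; _≢_)

record Graph (n : ℕ) : Set where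
  field
    adj    : Fin n → Fin n → Bool
    sym    : ∀ u v → adj u v ≡ adj v u
    irrefl : ∀ v → adj v v ≡ false
open Graph public

Proper : ∀ {n} {C : Set} → Graph n → (Fin n → C) → Set
Proper G f = ∀ u v → adj G u v ≡ true → f u ≢ f v

Colourable : ∀ {n} → Graph n → ℕ → Set
Colourable {n} G k = Σ (Fin n → Fin k) λ f → Proper G f

IsChromaticNumber : ∀ {n} → Graph n → ℕ → Set
IsChromaticNumber G k = Colourable G k × (∀ j → Colourable G j → k ≤ j)

Choosable : ∀ {n} → Graph n → ℕ → Set
Choosable {n} G k =
  (L : Fin n → List ℕ) →
  (∀ v → Unique (L v)) →
  (∀ v → k ≤ length (L v)) →
  Σ (Fin n → ℕ) λ f → (∀ v → f v ∈ L v) × Proper G f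

IsListChromaticNumber : ∀ {n} → Graph n → ℕ → Set
IsListChromaticNumber G k = Choosable G k × (∀ j → Choosable G j → k ≤ j)

joinAdj : ∀ {n} → Graph n → Fin (suc n) → Fin (suc n) → Bool
joinAdj G zero    zero    = false
joinAdj G zero    (suc v) = true
joinAdj G (suc u) zero    = true
joinAdj G (suc u) (suc v) = adj G u v

joinSym : ∀ {n} (G : Graph n) u v → joinAdj G u v ≡ joinAdj G v u
joinSym G zero    zero    = Relation.Binary.PropositionalEquality.refl
joinSym G zero    (suc v) = Relation.Binary.PropositionalEquality.refl
joinSym G (suc u) zero    = Relation.Binary.PropositionalEquality.refl
joinSym G (suc u) (suc v) = sym G u v

joinIrrefl : ∀ {n} (G : Graph n) v → joinAdj G v v ≡ false
joinIrrefl G zero    = Relation.Binary.PropositionalEquality.refl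
joinIrrefl G (suc v) = irrefl G v

K₁∨_ : ∀ {n} → Graph n → Graph (suc n)
K₁∨ G = record { adj = joinAdj G ; sym = joinSym G ; irrefl = joinIrrefl G }

-- The apex of the cone K₁ ∨ G is adjacent to everything. Colouring it from its own
-- list and deleting that colour from every other list leaves G with lists
-- one shorter, so χℓ(K₁ ∨ G) ≤ χℓ(G) + 1. Conversely a proper colouring of
-- K₁ ∨ G never reuses the apex colour on G, so G is coloured with one colour
-- fewer and χ(K₁ ∨ G) ≥ χ(G) + 1. Adding the two inequalities gives the claim.
module Submission where

open import Defs
open import Data.Nat using (ℕ; zero; suc; _+_; _≤_; z≤n; s≤s; s≤s⁻¹) renaming (_≟_ to _≟ℕ_)
open import Data.Nat.Properties using (≤-refl; ≤-trans; +-suc; +-monoˡ-≤; +-monoʳ-≤; module ≤-Reasoning)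
open import Data.Fin using (Fin; zero; suc; punchOut; fromℕ<)
open import Data.Fin.Properties using (punchOut-injective)
open import Data.Vec.Functional using () renaming (_∷_ to _◂_)
open import Data.List using (List; []; _∷_; length; filter; lookup)
open import Data.List.Properties using (filter-all)
open import Data.List.Membership.Propositional using (_∈_)
open import Data.List.Membership.Propositional.Properties using (∈-filter⁻; ∈-lookup)
open import Data.List.Relation.Unary.All as All using ()
open import Data.List.Relation.Unary.AllPairs using (_∷_)
open import Data.List.Relation.Unary.Unique.Propositional using (Unique)
open import Data.List.Relation.Unary.Unique.Propositional.Properties using (filter⁺)
open import Data.Product using (Σ; _×_; _,_; proj₁; proj₂)
open import Function using (_∘_)
open import Relation.Nullary using (yes; no; ¬?)
open import Relation.Binary.Definitions using (DecidableEquality)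
open import Relation.Binary.PropositionalEquality using (_≢_; refl; ≢-sym)

module _ {A : Set} (_≟_ : DecidableEquality A) where

  without : A → List A → List A
  without c = filter (¬? ∘ (_≟ c))

  without-unique : ∀ c {xs} → Unique xs → Unique (without c xs)
  without-unique c = filter⁺ (¬? ∘ (_≟ c))

  ∈-without⁻ : ∀ c {xs y} → y ∈ without c xs → y ∈ xs × y ≢ c
  ∈-without⁻ c = ∈-filter⁻ (¬? ∘ (_≟ c))

  length-without : ∀ c {xs} → Unique xs → length xs ≤ suc (length (without c xs))
  length-without c {[]}     _             = z≤n
  length-without c {x ∷ xs} (x∉xs ∷ uniq) with x ≟ c
  ... | yes refl rewrite filter-all (¬? ∘ (_≟ x)) (All.map ≢-sym x∉xs) = ≤-refl
  ... | no _     = s≤s (length-without c uniq)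

module _ {n} (G : Graph n) where

  coneProper : ∀ {C : Set} (c : C) (f : Fin n → C) →
               Proper G f → (∀ v → f v ≢ c) → Proper (K₁∨ G) (c ◂ f)
  coneProper c f proper avoids zero    (suc v) _    = ≢-sym (avoids v)
  coneProper c f proper avoids (suc u) zero    _    = avoids u
  coneProper c f proper avoids (suc u) (suc v) u~v  = proper u v u~v

  coneChoosable : ∀ k → Choosable G k → Choosable (K₁∨ G) (suc k)
  coneChoosable k choose L unique long = c ◂ f , chosen∈ , coneProper c f proper avoids
    where
    c : ℕ
    c = lookup (L zero) (fromℕ< (long zero))
    L′ : Fin n → List ℕ
    L′ v = without _≟ℕ_ c (L (suc v))
    long′ : ∀ v → k ≤ length (L′ v)
    long′ v = s≤s⁻¹ (≤-trans (long (suc v)) (length-without _≟ℕ_ c (unique (suc v))))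
    chosen : Σ (Fin n → ℕ) λ f → (∀ v → f v ∈ L′ v) × Proper G f
    chosen = choose L′ (without-unique _≟ℕ_ c ∘ unique ∘ suc) long′
    f : Fin n → ℕ
    f = proj₁ chosen
    proper : Proper G f
    proper = proj₂ (proj₂ chosen)
    f∈L′ : ∀ v → f v ∈ L (suc v) × f v ≢ c
    f∈L′ v = ∈-without⁻ _≟ℕ_ c {L (suc v)} (proj₁ (proj₂ chosen) v)
    avoids : ∀ v → f v ≢ c
    avoids = proj₂ ∘ f∈L′
    chosen∈ : ∀ v → (c ◂ f) v ∈ L v
    chosen∈ zero    = ∈-lookup _
    chosen∈ (suc v) = proj₁ (f∈L′ v)

  coneColourable⁻ : ∀ m → Colourable (K₁∨ G) (suc m) → Colourable G m
  coneColourable⁻ m (f , proper) = g , g-proper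
    where
    apex≢ : ∀ v → f zero ≢ f (suc v)
    apex≢ v = proper zero (suc v) refl
    g : Fin n → Fin m
    g v = punchOut (apex≢ v)
    g-proper : Proper G g
    g-proper u v u~v = proper (suc u) (suc v) u~v ∘ punchOut-injective (apex≢ u) (apex≢ v)

  listChromaticNumber-cone≤ : ∀ {χℓG χℓJ} → IsListChromaticNumber G χℓG →
                       IsListChromaticNumber (K₁∨ G) χℓJ → χℓJ ≤ suc χℓG
  listChromaticNumber-cone≤ (choosable , _) (_ , least) = least _ (coneChoosable _ choosable)

  chromaticNumber-cone≥ : ∀ {χG χJ} → IsChromaticNumber G χG →
                   IsChromaticNumber (K₁∨ G) χJ → suc χG ≤ χJ
  chromaticNumber-cone≥ {χJ = zero}  _          ((f , _) , _) with f zero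
  ... | ()
  chromaticNumber-cone≥ {χJ = suc m} (_ , least) (colourable , _) =
    s≤s (least m (coneColourable⁻ m colourable))

lemma15 : ∀ (n : ℕ) (G : Graph (suc n)) (χG χℓG χJ χℓJ : ℕ) →
    IsChromaticNumber G χG → IsListChromaticNumber G χℓG →
    IsChromaticNumber (K₁∨ G) χJ → IsListChromaticNumber (K₁∨ G) χℓJ →
    χℓJ + χG ≤ χℓG + χJ
lemma15 n G χG χℓG χJ χℓJ isχG isχℓG isχJ isχℓJ = begin
  χℓJ + χG       ≤⟨ +-monoˡ-≤ χG (listChromaticNumber-cone≤ G isχℓG isχℓJ) ⟩
  suc χℓG + χG   ≡⟨ +-suc χℓG χG ⟨
  χℓG + suc χG   ≤⟨ +-monoʳ-≤ χℓG (chromaticNumber-cone≥ G isχG isχJ) ⟩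
  χℓG + χJ       ∎
  where open ≤-Reasoning
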